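{- For any set of rule schemes $\mathcal{R}\subseteq\{N,H,P,F,wF\}$ there exists a non-commutative spacetime $\mathcal{S}\in\mathbf{ST}(\mathcal{R})$ such that for every sequent $\Gamma\Rightarrow A$ of $\mathcal{L}_\nabla$, if $\mathcal{S}\vDash\Gamma\Rightarrow A$ then $\mathbf{STL}(\mathcal{R})\vdash\Gamma\Rightarrow A$. Likewise, there exists a spacetime $\mathcal{S}\in i\mathbf{ST}(\mathcal{R})$ such that if $\mathcal{S}\vDash\Gamma\Rightarrow A$ then $i\mathbf{STL}(\mathcal{R})\vdash\Gamma\Rightarrow A$.
   Context: Language $\mathcal{L}_\nabla$: formulas built from propositional atoms and constants $\top,\bot,1$ by binary $\wedge,\vee,\otimes,\to$ and unary $\nabla$. A sequent is $\Gamma\Rightarrow A$ with $\Gamma$ a finite (possibly empty) sequence of formulas; $\nabla\Gamma$ applies $\nabla$ to each member. The system $\mathbf{STL}$ has: axioms $A\Rightarrow A$; $\Rightarrow 1$; $\nabla 1\Rightarrow 1$; $\Gamma\Rightarrow\top$; $\Gamma,\bot,\Sigma\Rightarrow A$. Cut: from $\Gamma\Rightarrow A$ and $\Pi,A,\Sigma\Rightarrow B$ infer $\Pi,\Gamma,\Sigma\Rightarrow B$. $L\wedge$: from $\Gamma,A,\Sigma\Rightarrow C$ infer $\Gamma,A\wedge B,\Sigma\Rightarrow C$ and $\Gamma,B\wedge A,\Sigma\Rightarrow C$. $R\wedge$: from $\Gamma\Rightarrow A$, $\Gamma\Rightarrow B$ infer $\Gamma\Rightarrow A\wedge B$. $L\vee$: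 from $\Gamma,A,\Sigma\Rightarrow C$ and $\Gamma,B,\Sigma\Rightarrow C$ infer $\Gamma,A\vee B,\Sigma\Rightarrow C$. $R\vee$: from $\Gamma\Rightarrow A$ infer $\Gamma\Rightarrow A\vee B$ and $\Gamma\Rightarrow B\vee A$. $L1$: from $\Gamma,\Sigma\Rightarrow A$ infer $\Gamma,1,\Sigma\Rightarrow A$. $L\otimes$: from $\Gamma,A,B,\Sigma\Rightarrow C$ infer $\Gamma,A\otimes B,\Sigma\Rightarrow C$. $R\otimes$: from $\Gamma\Rightarrow A$, $\Sigma\Rightarrow B$ infer $\Gamma,\Sigma\Rightarrow A\otimes B$. Rule $\nabla$: from $A\Rightarrow B$ infer $\nabla A\Rightarrow\nabla B$. Oplax: from $\nabla A,\nabla B\Rightarrow C$ infer $\nabla(A\otimes B)\Rightarrow C$. $L\to$: from $\Gamma\Rightarrow A$ and $\Pi,B,\Sigma\Rightarrow C$ infer $\Pi,\Gamma,\nabla(A\to B),\Sigma\Rightarrow C$. $R\to$: from $A,\nabla\Gamma\Rightarrow B$ infer $\Gamma\Rightarrow A\to B$. Rule schemes: $(N)$ from $\Gamma\Rightarrow A$ infer $\nabla\Gamma\Rightarrow\nabla A$; $(P)$ from $\Gamma\Rightarrow\nabla A$ infer $\Gamma\Rightarrow A$; $(F)$ from $\Gamma\Rightarrow A$ infer $\Gamma\Rightarrow\nabla A$; $(wF)$ from $\nabla A\Rightarrow\bot$ infer $A\Rightarrow\bot$; $(H)$ from $\Gamma,A_1\to B_1,\dots,A_n\to B_n\Rightarrow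 C$ infer $\nabla\Gamma,\nabla A_1\to\nabla B_1,\dots,\nabla A_n\to\nabla B_n\Rightarrow\nabla C$ ($n\geq0$). Structural rules: weakening, contraction and exchange on the left. $\mathbf{STL}(\mathcal{R})$ is $\mathbf{STL}$ plus the schemes in $\mathcal{R}$; $i\mathbf{STL}(\mathcal{R})$ adds the structural rules. Semantics: a quantale is a monoidal poset (poset with monoid $(\otimes,e)$, $\otimes$ monotone) with all joins and $\otimes$ distributing over arbitrary joins on both sides; a locale is a quantale with multiplication binary meet and unit the top. A non-commutative spacetime is $(\mathscr{X},\nabla)$ with $\mathscr{X}$ a quantale and $\nabla$ join preserving, $\nabla e\leq e$, $\nabla(a\otimes b)\leq\nabla a\otimes\nabla b$; a spacetime is one with $\mathscr{X}$ a locale. Its implication $\to_{\mathcal{S}}$: $a\otimes\nabla b\leq c$ iff $b\leq a\to_{\mathcal{S}}c$. A valuation $V$ maps atoms to $\mathscr{X}$ and extends by $V(1)=e$, $V(\bot)=$ bottom, $V(\top)=$ top, meets, joins, $\otimes$, $\nabla$ and $\to_{\mathcal{S}}$ interpreting $\wedge,\vee,\otimes,\nabla,\to$. $(\mathcal{S},V)\vDash\Gamma\Rightarrow A$ means $V(\gamma_1)\otimes\cdots\otimes V(\gamma_n)\leq V(A)$ (empty product $=e$); $\mathcal{S}\vDash\Gamma\Rightarrow A$ means this for all $V$. Conditions on $(\mathscr{X},\nabla)$: $(N)$ $\nabla e=e$, $\nabla(a\otimes b)=\nabla a\otimes\nabla b$; $(H)$ $\nabla$ preserves all the structure including $\to_{\mathcal{S}}$;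 $(P)$ $\nabla a\leq a$; $(F)$ $a\leq\nabla a$; $(wF)$ $\nabla a=0$ implies $a=0$. $\mathbf{ST}(\mathcal{R})$ is the class of non-commutative spacetimes satisfying the conditions in $\mathcal{R}$; $i\mathbf{ST}(\mathcal{R})$ the class of such spacetimes. -}

module Defs where

open import Level using (Level; _⊔_; suc; Lift; lift)
open import Data.Nat using (ℕ)
open import Data.Bool using (Bool; true; false; T)
open import Data.Empty using (⊥)
open import Data.Product using (Σ; _×_; _,_)
open import Data.List using (List; []; _∷_; _++_; map)

infixr 6 _∧ᶠ_
infixr 5 _∨ᶠ_
infixr 7 _⊗ᶠ_
infixr 4 _→ᶠ_

data Fm : Set where
  atom : ℕ → Fm
  ⊤ᶠ ⊥ᶠ 𝟙ᶠ : Fm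
  _∧ᶠ_ _∨ᶠ_ _⊗ᶠ_ _→ᶠ_ : Fm → Fm → Fm
  ∇ᶠ : Fm → Fm

∇* : List Fm → List Fm
∇* = map ∇ᶠ

data Scheme : Set where
  sN sH sP sF swF : Scheme

-- R : Scheme → Bool  is the set of schemes; membership is T (R s)
-- i = true adds the structural rules (weakening, contraction, exchange)

impl : Fm × Fm → Fm
impl (a , b) = a →ᶠ b

∇impl : Fm × Fm → Fm
∇impl (a , b) = ∇ᶠ a →ᶠ ∇ᶠ b

infix 3 Der

-- Der R i Γ A :  STL(R) ⊢ Γ ⇒ A   (i = false)  /  iSTL(R) ⊢ Γ ⇒ A  (i = true)
data Der (R : Scheme → Bool) (i : Bool) : List Fm → Fm → Set where
  ax    : ∀ {A} → Der R i (A ∷ []) A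
  one   : Der R i [] 𝟙ᶠ
  ∇one  : Der R i (∇ᶠ 𝟙ᶠ ∷ []) 𝟙ᶠ
  top   : ∀ {Γ} → Der R i Γ ⊤ᶠ
  bot   : ∀ {Γ Σ' A} → Der R i (Γ ++ ⊥ᶠ ∷ Σ') A
  cut   : ∀ {Γ Π Σ' A B} → Der R i Γ A → Der R i (Π ++ A ∷ Σ') B →
          Der R i (Π ++ Γ ++ Σ') B
  L∧₁   : ∀ {Γ Σ' A B C} → Der R i (Γ ++ A ∷ Σ') C → Der R i (Γ ++ (A ∧ᶠ B) ∷ Σ') C
  L∧₂   : ∀ {Γ Σ' A B C} → Der R i (Γ ++ A ∷ Σ') C → Der R i (Γ ++ (B ∧ᶠ A) ∷ Σ') C
  R∧    : ∀ {Γ A B} → Der R i Γ A → Der R i Γ B → Der R i Γ (A ∧ᶠ B)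
  L∨    : ∀ {Γ Σ' A B C} → Der R i (Γ ++ A ∷ Σ') C → Der R i (Γ ++ B ∷ Σ') C →
          Der R i (Γ ++ (A ∨ᶠ B) ∷ Σ') C
  R∨₁   : ∀ {Γ A B} → Der R i Γ A → Der R i Γ (A ∨ᶠ B)
  R∨₂   : ∀ {Γ A B} → Der R i Γ A → Der R i Γ (B ∨ᶠ A)
  L1    : ∀ {Γ Σ' A} → Der R i (Γ ++ Σ') A → Der R i (Γ ++ 𝟙ᶠ ∷ Σ') A
  L⊗    : ∀ {Γ Σ' A B C} → Der R i (Γ ++ A ∷ B ∷ Σ') C → Der R i (Γ ++ (A ⊗ᶠ B) ∷ Σ') C
  R⊗    : ∀ {Γ Σ' A B} → Der R i Γ A → Der R i Σ' B → Der R i (Γ ++ Σ') (A ⊗ᶠ B)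
  ∇rule : ∀ {A B} → Der R i (A ∷ []) B → Der R i (∇ᶠ A ∷ []) (∇ᶠ B)
  oplax : ∀ {A B C} → Der R i (∇ᶠ A ∷ ∇ᶠ B ∷ []) C → Der R i (∇ᶠ (A ⊗ᶠ B) ∷ []) C
  L→    : ∀ {Γ Π Σ' A B C} → Der R i Γ A → Der R i (Π ++ B ∷ Σ') C →
          Der R i (Π ++ Γ ++ ∇ᶠ (A →ᶠ B) ∷ Σ') C
  R→    : ∀ {Γ A B} → Der R i (A ∷ ∇* Γ) B → Der R i Γ (A →ᶠ B)
  ruleN : ∀ {Γ A} → T (R sN) → Der R i Γ A → Der R i (∇* Γ) (∇ᶠ A)
  ruleP : ∀ {Γ A} → T (R sP) → Der R i Γ (∇ᶠ A) → Der R i Γ A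
  ruleF : ∀ {Γ A} → T (R sF) → Der R i Γ A → Der R i Γ (∇ᶠ A)
  rulewF : ∀ {A} → T (R swF) → Der R i (∇ᶠ A ∷ []) ⊥ᶠ → Der R i (A ∷ []) ⊥ᶠ
  ruleH : ∀ {Γ C} (ps : List (Fm × Fm)) → T (R sH) →
          Der R i (Γ ++ map impl ps) C →
          Der R i (∇* Γ ++ map ∇impl ps) (∇ᶠ C)
  weak  : ∀ {Γ Σ' A C} → T i → Der R i (Γ ++ Σ') C → Der R i (Γ ++ A ∷ Σ') C
  contr : ∀ {Γ Σ' A C} → T i → Der R i (Γ ++ A ∷ A ∷ Σ') C → Der R i (Γ ++ A ∷ Σ') C
  exch  : ∀ {Γ Σ' A B C} → T i → Der R i (Γ ++ A ∷ B ∷ Σ') C →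
          Der R i (Γ ++ B ∷ A ∷ Σ') C

STL : (Scheme → Bool) → List Fm → Fm → Set
STL R = Der R false

iSTL : (Scheme → Bool) → List Fm → Fm → Set
iSTL R = Der R true

-- Joins of all families indexed by types in Set ι (predicative completeness).
-- Binary meets and top (which exist in any complete lattice) are given
-- explicitly because impredicative meets cannot be formed from ⋁.

record Quantale (c ℓ ι : Level) : Set (suc (c ⊔ ℓ ⊔ ι)) where
  infix 4 _≤_ _≈_
  infixr 7 _⊗_
  infixr 6 _∧_
  field
    Carrier : Set c
    _≤_     : Carrier → Carrier → Set ℓ
    ≤-refl  : ∀ {a} → a ≤ a
    ≤-trans : ∀ {a b d} → a ≤ b → b ≤ d → a ≤ d
  _≈_ : Carrier → Carrier → Set ℓ
  a ≈ b = (a ≤ b) × (b ≤ a)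
  field
    _⊗_     : Carrier → Carrier → Carrier
    e       : Carrier
    ⊗-assoc : ∀ a b d → ((a ⊗ b) ⊗ d) ≈ (a ⊗ (b ⊗ d))
    ⊗-idˡ   : ∀ a → (e ⊗ a) ≈ a
    ⊗-idʳ   : ∀ a → (a ⊗ e) ≈ a
    ⊗-mono  : ∀ {a a' b b'} → a ≤ a' → b ≤ b' → (a ⊗ b) ≤ (a' ⊗ b')
    ⋁       : {I : Set ι} → (I → Carrier) → Carrier
    ⋁-ub    : {I : Set ι} (f : I → Carrier) (k : I) → f k ≤ ⋁ f
    ⋁-least : {I : Set ι} (f : I → Carrier) (b : Carrier) →
              (∀ k → f k ≤ b) → ⋁ f ≤ b
    ⊗-distribˡ : ∀ a {I : Set ι} (f : I → Carrier) →
                 (a ⊗ ⋁ f) ≈ ⋁ (λ k → a ⊗ f k)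
    ⊗-distribʳ : ∀ a {I : Set ι} (f : I → Carrier) →
                 (⋁ f ⊗ a) ≈ ⋁ (λ k → f k ⊗ a)
    _∧_     : Carrier → Carrier → Carrier
    ∧-lb₁   : ∀ a b → (a ∧ b) ≤ a
    ∧-lb₂   : ∀ a b → (a ∧ b) ≤ b
    ∧-glb   : ∀ {a b d} → d ≤ a → d ≤ b → d ≤ (a ∧ b)
    ⊤q      : Carrier
    ⊤-max   : ∀ a → a ≤ ⊤q

  ⊥q : Carrier
  ⊥q = ⋁ {I = Lift ι ⊥} (λ ())

  _∨_ : Carrier → Carrier → Carrier
  a ∨ b = ⋁ {I = Lift ι Bool} (λ { (lift true) → a ; (lift false) → b })

IsLocale : ∀ {c ℓ ι} → Quantale c ℓ ι → Set (c ⊔ ℓ)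
IsLocale Q = (∀ a b → (a ⊗ b) ≈ (a ∧ b)) × (e ≈ ⊤q)
  where open Quantale Q

record NCSpacetime (c ℓ ι : Level) : Set (suc (c ⊔ ℓ ⊔ ι)) where
  field
    X : Quantale c ℓ ι
  open Quantale X public
  field
    ∇       : Carrier → Carrier
    ∇-mono  : ∀ {a b} → a ≤ b → ∇ a ≤ ∇ b
    ∇-join  : {I : Set ι} (f : I → Carrier) → ∇ (⋁ f) ≈ ⋁ (λ k → ∇ (f k))
    ∇-e     : ∇ e ≤ e
    ∇-⊗     : ∀ a b → ∇ (a ⊗ b) ≤ (∇ a ⊗ ∇ b)
    _⇒_     : Carrier → Carrier → Carrier
    ⇒-intro : ∀ {a b d} → (a ⊗ ∇ b) ≤ d → b ≤ (a ⇒ d)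
    ⇒-elim  : ∀ {a b d} → b ≤ (a ⇒ d) → (a ⊗ ∇ b) ≤ d

IsSpacetime : ∀ {c ℓ ι} → NCSpacetime c ℓ ι → Set (c ⊔ ℓ)
IsSpacetime S = IsLocale (NCSpacetime.X S)

Cond : ∀ {c ℓ ι} → Scheme → NCSpacetime c ℓ ι → Set (c ⊔ ℓ)
Cond sN S = (∇ e ≈ e) × (∀ a b → ∇ (a ⊗ b) ≈ (∇ a ⊗ ∇ b))
  where open NCSpacetime S
Cond sH S = (∇ e ≈ e) × (∀ a b → ∇ (a ⊗ b) ≈ (∇ a ⊗ ∇ b))
          × (∀ a b → ∇ (a ∧ b) ≈ (∇ a ∧ ∇ b)) × (∇ ⊤q ≈ ⊤q)
          × (∀ a b → ∇ (a ⇒ b) ≈ (∇ a ⇒ ∇ b))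
  where open NCSpacetime S
Cond sP S = ∀ a → ∇ a ≤ a
  where open NCSpacetime S
Cond sF S = ∀ a → a ≤ ∇ a
  where open NCSpacetime S
Cond swF S = ∀ a → ∇ a ≈ ⊥q → a ≈ ⊥q
  where open NCSpacetime S

InST : ∀ {c ℓ ι} → (Scheme → Bool) → NCSpacetime c ℓ ι → Set (c ⊔ ℓ)
InST R S = ∀ s → T (R s) → Cond s S

module _ {c ℓ ι} (S : NCSpacetime c ℓ ι) where
  open NCSpacetime S

  ⟦_⟧ : (ℕ → Carrier) → Fm → Carrier
  ⟦ V ⟧ (atom p)  = V p
  ⟦ V ⟧ ⊤ᶠ        = ⊤q
  ⟦ V ⟧ ⊥ᶠ        = ⊥q
  ⟦ V ⟧ 𝟙ᶠ        = e
  ⟦ V ⟧ (A ∧ᶠ B)  = ⟦ V ⟧ A ∧ ⟦ V ⟧ B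
  ⟦ V ⟧ (A ∨ᶠ B)  = ⟦ V ⟧ A ∨ ⟦ V ⟧ B
  ⟦ V ⟧ (A ⊗ᶠ B)  = ⟦ V ⟧ A ⊗ ⟦ V ⟧ B
  ⟦ V ⟧ (A →ᶠ B)  = ⟦ V ⟧ A ⇒ ⟦ V ⟧ B
  ⟦ V ⟧ (∇ᶠ A)    = ∇ (⟦ V ⟧ A)

  ⟦_⟧* : (ℕ → Carrier) → List Fm → Carrier
  ⟦ V ⟧* []      = e
  ⟦ V ⟧* (A ∷ Γ) = ⟦ V ⟧ A ⊗ ⟦ V ⟧* Γ

  Valid : List Fm → Fm → Set (c ⊔ ℓ)
  Valid Γ A = ∀ (V : ℕ → Carrier) → ⟦ V ⟧* Γ ≤ ⟦ V ⟧ A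

module Submission where

-- The canonical model is a syntactic "phase space".  Its points are
-- structured sequents: lists whose entries are formulas or nested layers
-- ∇(…) and, when H ∈ R, G(…) with G X = 1 → X.  A contextual closure cl
-- says that s belongs to cl Q when every derivable sequent C[t] ⇒ c, for
-- all t ∈ Q, stays derivable with t replaced by s.  Predicates ordered by
-- P ⊑ Q iff P ⊆ cl Q form a quantale (⊗ = concatenation, ⋁ = union), ∇
-- wraps a point in a ∇-layer and ⇒ is its residual.

open import Defs
open import Level using (Level; suc; Lift; lift)
open import Data.Bool using (Bool; true; false; T)
open import Data.List using (List; []; _∷_; _++_)
open import Data.List.Properties using (++-assoc; ++-identityʳ)
open import Data.Product using (Σ; _×_; _,_; proj₁; proj₂)
open import Data.Sum using (_⊎_; inj₁; inj₂)
open import Data.Unit using (⊤; tt)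
open import Data.Nat using (ℕ)
open import Relation.Binary.PropositionalEquality using (_≡_; refl; sym; trans; cong; subst)

module Derived (R : Scheme → Bool) (i : Bool) where

  infix 3 _⊢_
  _⊢_ : List Fm → Fm → Set
  _⊢_ = Der R i

  cast : ∀ {Γ Γ' C} → Γ ≡ Γ' → Γ ⊢ C → Γ' ⊢ C
  cast refl d = d

  cut₁ : ∀ {A B C} → A ∷ [] ⊢ B → B ∷ [] ⊢ C → A ∷ [] ⊢ C
  cut₁ {A} d e = cut {Γ = A ∷ []} {Π = []} {Σ' = []} d e

  cutAt : ∀ Π Σ' {A B C} → A ∷ [] ⊢ B → Π ++ B ∷ Σ' ⊢ C → Π ++ A ∷ Σ' ⊢ C
  cutAt Π Σ' {A} d e = cut {Γ = A ∷ []} {Π = Π} {Σ' = Σ'} d e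

  cutEnd : ∀ {Γ A C} → Γ ⊢ A → A ∷ [] ⊢ C → Γ ⊢ C
  cutEnd {Γ} d e = cast (++-identityʳ Γ) (cut {Γ = Γ} {Π = []} {Σ' = []} d e)

  ⨂ : List Fm → Fm
  ⨂ [] = 𝟙ᶠ
  ⨂ (A ∷ []) = A
  ⨂ (A ∷ B ∷ Γ) = A ⊗ᶠ ⨂ (B ∷ Γ)

  ⨂-R : ∀ Δ → Δ ⊢ ⨂ Δ
  ⨂-R [] = one
  ⨂-R (A ∷ []) = ax
  ⨂-R (A ∷ B ∷ Δ) = R⊗ {Γ = A ∷ []} {Σ' = B ∷ Δ} ax (⨂-R (B ∷ Δ))

  ⨂-L : ∀ Π Δ Σ' {C} → Π ++ Δ ++ Σ' ⊢ C → Π ++ ⨂ Δ ∷ Σ' ⊢ C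
  ⨂-L Π [] Σ' d = L1 {Γ = Π} {Σ' = Σ'} d
  ⨂-L Π (A ∷ []) Σ' d = d
  ⨂-L Π (A ∷ B ∷ Δ) Σ' d =
    L⊗ {Γ = Π} {Σ' = Σ'} {A = A} {B = ⨂ (B ∷ Δ)}
      (cast (++-assoc Π (A ∷ []) _)
        (⨂-L (Π ++ A ∷ []) (B ∷ Δ) Σ' (cast (sym (++-assoc Π (A ∷ []) _)) d)))

  ⨂-pack : ∀ {Γ C} → Γ ⊢ C → ⨂ Γ ∷ [] ⊢ C
  ⨂-pack {Γ} d = ⨂-L [] Γ [] (cast (sym (++-identityʳ Γ)) d)

  ⨂-unpack : ∀ {Γ C} → ⨂ Γ ∷ [] ⊢ C → Γ ⊢ C
  ⨂-unpack {Γ} d = cutEnd (⨂-R Γ) d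

  ⨂-++ : ∀ xs ys → ⨂ xs ∷ ⨂ ys ∷ [] ⊢ ⨂ (xs ++ ys)
  ⨂-++ xs ys = ⨂-L (⨂ xs ∷ []) ys []
    (cast (cong (⨂ xs ∷_) (sym (++-identityʳ ys))) (⨂-L [] xs ys (⨂-R (xs ++ ys))))

  ⨂-split : ∀ xs ys → ⨂ (xs ++ ys) ∷ [] ⊢ ⨂ xs ⊗ᶠ ⨂ ys
  ⨂-split xs ys = ⨂-pack (R⊗ {Γ = xs} {Σ' = ys} (⨂-R xs) (⨂-R ys))

  -- G X = 1 → X is right adjoint to ∇:  ∇ A ⊢ X  iff  A ⊢ G X.
  G : Fm → Fm
  G X = 𝟙ᶠ →ᶠ X

  counit : ∀ {X} → ∇ᶠ (G X) ∷ [] ⊢ X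
  counit = L→ {Γ = []} {Π = []} {Σ' = []} one ax

  unit : ∀ {X} → X ∷ [] ⊢ G (∇ᶠ X)
  unit {X} = R→ {Γ = X ∷ []} (L1 {Γ = []} {Σ' = ∇ᶠ X ∷ []} ax)

  G-mono : ∀ {X Y} → X ∷ [] ⊢ Y → G X ∷ [] ⊢ G Y
  G-mono {X} d = R→ {Γ = G X ∷ []} (L1 {Γ = []} {Σ' = ∇ᶠ (G X) ∷ []} (cut₁ counit d))

  to-∇1⇒∇ : ∀ {X} → X ∷ [] ⊢ ∇ᶠ 𝟙ᶠ →ᶠ ∇ᶠ X
  to-∇1⇒∇ {X} = R→ {Γ = X ∷ []}
    (cutAt [] (∇ᶠ X ∷ []) ∇one (L1 {Γ = []} {Σ' = ∇ᶠ X ∷ []} ax))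

  -- With H, ∇ commutes with G, and then unit and counit are invertible:
  -- ∇ and G are mutually inverse up to interderivability.
  module WithH (h : T (R sH)) where

    ∇-G : ∀ {X} → (∇ᶠ 𝟙ᶠ →ᶠ ∇ᶠ X) ∷ [] ⊢ ∇ᶠ (G X)
    ∇-G {X} = ruleH {Γ = []} ((𝟙ᶠ , X) ∷ []) h ax

    counit⁻¹ : ∀ {X} → X ∷ [] ⊢ ∇ᶠ (G X)
    counit⁻¹ = cut₁ to-∇1⇒∇ ∇-G

    unit⁻¹ : ∀ {X} → G (∇ᶠ X) ∷ [] ⊢ X
    unit⁻¹ {X} = cut₁ (cut₁ weaken-unit ∇-G) counit
      where
      weaken-unit : G (∇ᶠ X) ∷ [] ⊢ ∇ᶠ 𝟙ᶠ →ᶠ ∇ᶠ X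
      weaken-unit = R→ {Γ = G (∇ᶠ X) ∷ []}
        (cutAt [] (∇ᶠ (G (∇ᶠ X)) ∷ []) ∇one (L1 {Γ = []} {Σ' = ∇ᶠ (G (∇ᶠ X)) ∷ []} counit))

  -- The layers of structured sequents: ∇ always, G only when H ∈ R,
  -- since only then does G preserve joins (it is inverse to ∇).
  data Layer : Set where
    ∇-layer : Layer
    G-layer : T (R sH) → Layer

  layer : Layer → Fm → Fm
  layer ∇-layer X = ∇ᶠ X
  layer (G-layer _) X = G X

  layer-mono : ∀ l {X Y} → X ∷ [] ⊢ Y → layer l X ∷ [] ⊢ layer l Y
  layer-mono ∇-layer d = ∇rule d
  layer-mono (G-layer _) d = G-mono d

  -- layers preserve binary joins and the bottom; for ∇ this holds because
  -- ∇ is a left adjoint, for G because it is inverse to ∇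
  layer-∨ : ∀ l {X Y} → layer l (X ∨ᶠ Y) ∷ [] ⊢ layer l X ∨ᶠ layer l Y
  layer-∨ ∇-layer = cut₁ (∇rule (L∨ {Γ = []} {Σ' = []}
    (cut₁ unit (G-mono (R∨₁ ax))) (cut₁ unit (G-mono (R∨₂ ax))))) counit
  layer-∨ (G-layer h) = cut₁ (G-mono (L∨ {Γ = []} {Σ' = []}
    (cut₁ counit⁻¹ (∇rule (R∨₁ ax))) (cut₁ counit⁻¹ (∇rule (R∨₂ ax))))) unit⁻¹
    where open WithH h

  layer-⊥ : ∀ l → layer l ⊥ᶠ ∷ [] ⊢ ⊥ᶠ
  layer-⊥ ∇-layer = cut₁ (∇rule (bot {Γ = []} {Σ' = []})) counit
  layer-⊥ (G-layer h) = cut₁ (G-mono (bot {Γ = []} {Σ' = []})) unit⁻¹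
    where open WithH h

  -- Necessitation Γ ⊢ A / ∇Γ ⊢ ∇A holds if N ∈ R, and also if H ∈ R
  -- (the case n = 0 of the H rule).
  necessitation : T (R sN) ⊎ T (R sH) → ∀ {Γ A} → Γ ⊢ A → ∇* Γ ⊢ ∇ᶠ A
  necessitation (inj₁ n) d = ruleN n d
  necessitation (inj₂ h) {Γ} d =
    cast (++-identityʳ (∇* Γ)) (ruleH {Γ = Γ} [] h (cast (sym (++-identityʳ Γ)) d))

  data Struct : Set where
    fm  : Fm → Struct
    lay : Layer → List Struct → Struct

  tr  : Struct → Fm
  tr* : List Struct → List Fm
  tr (fm A) = A
  tr (lay l s) = layer l (⨂ (tr* s))
  tr* [] = []
  tr* (x ∷ s) = tr x ∷ tr* s

  tr*-++ : ∀ x y → tr* (x ++ y) ≡ tr* x ++ tr* y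
  tr*-++ [] y = refl
  tr*-++ (a ∷ x) y = cong (tr a ∷_) (tr*-++ x y)

  ⨂-++* : ∀ p q → ⨂ (tr* p) ∷ ⨂ (tr* q) ∷ [] ⊢ ⨂ (tr* (p ++ q))
  ⨂-++* p q =
    subst (λ z → ⨂ (tr* p) ∷ ⨂ (tr* q) ∷ [] ⊢ ⨂ z) (sym (tr*-++ p q)) (⨂-++ (tr* p) (tr* q))

  castTr : ∀ {s t C} → s ≡ t → tr* s ⊢ C → tr* t ⊢ C
  castTr eq = cast (cong tr* eq)

  data Ctx : Set where
    hole : List Struct → List Struct → Ctx
    deep : List Struct → Layer → Ctx → List Struct → Ctx

  plug : Ctx → List Struct → List Struct
  plug (hole Π Σ') Δ = Π ++ Δ ++ Σ'
  plug (deep Π l C Σ') Δ = Π ++ lay l (plug C Δ) ∷ Σ'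

  extendʳ : Ctx → List Struct → Ctx
  extendʳ (hole Π Σ') y = hole Π (y ++ Σ')
  extendʳ (deep Π l C Σ') y = deep Π l (extendʳ C y) Σ'

  plug-extendʳ : ∀ C x y → plug (extendʳ C y) x ≡ plug C (x ++ y)
  plug-extendʳ (hole Π Σ') x y = cong (Π ++_) (sym (++-assoc x y Σ'))
  plug-extendʳ (deep Π l C Σ') x y = cong (λ z → Π ++ lay l z ∷ Σ') (plug-extendʳ C x y)

  extendˡ : Ctx → List Struct → Ctx
  extendˡ (hole Π Σ') x = hole (Π ++ x) Σ'
  extendˡ (deep Π l C Σ') x = deep Π l (extendˡ C x) Σ'

  plug-extendˡ : ∀ C x y → plug (extendˡ C x) y ≡ plug C (x ++ y)
  plug-extendˡ (hole Π Σ') x y =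
    trans (++-assoc Π x (y ++ Σ')) (cong (Π ++_) (sym (++-assoc x y Σ')))
  plug-extendˡ (deep Π l C Σ') x y = cong (λ z → Π ++ lay l z ∷ Σ') (plug-extendˡ C x y)

  inLayer : Layer → Ctx → Ctx
  inLayer l (hole Π Σ') = deep Π l (hole [] []) Σ'
  inLayer l (deep Π l' C Σ') = deep Π l' (inLayer l C) Σ'

  plug-inLayer : ∀ l C x → plug (inLayer l C) x ≡ plug C (lay l x ∷ [])
  plug-inLayer l (hole Π Σ') x = cong (λ z → Π ++ lay l z ∷ Σ') (++-identityʳ x)
  plug-inLayer l (deep Π l' C Σ') x = cong (λ z → Π ++ lay l' z ∷ Σ') (plug-inLayer l C x)

  flat-hole : ∀ Π Δ Σ' → tr* (Π ++ Δ ++ Σ') ≡ tr* Π ++ tr* Δ ++ tr* Σ'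
  flat-hole Π Δ Σ' = trans (tr*-++ Π _) (cong (tr* Π ++_) (tr*-++ Δ Σ'))

  flat-deep : ∀ Π l z Σ' → tr* (Π ++ lay l z ∷ Σ') ≡ tr* Π ++ tr (lay l z) ∷ tr* Σ'
  flat-deep Π l z Σ' = tr*-++ Π _

  cutLayer : ∀ Π l z Σ' {X C} → tr (lay l z) ∷ [] ⊢ X → tr* Π ++ X ∷ tr* Σ' ⊢ C →
             tr* (Π ++ lay l z ∷ Σ') ⊢ C
  cutLayer Π l z Σ' d e = cast (sym (flat-deep Π l z Σ')) (cutAt (tr* Π) (tr* Σ') d e)

  deep-cut : ∀ {s Δ} → tr* s ⊢ ⨂ (tr* Δ) →
             ∀ C c → tr* (plug C Δ) ⊢ c → tr* (plug C s) ⊢ c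
  deep-cut {s} {Δ} d (hole Π Σ') c e =
    cast (sym (flat-hole Π s Σ'))
      (cut {Γ = tr* s} {Π = tr* Π} {Σ' = tr* Σ'} d
        (⨂-L (tr* Π) (tr* Δ) (tr* Σ') (cast (flat-hole Π Δ Σ') e)))
  deep-cut {s} {Δ} d (deep Π l C Σ') c e =
    cutLayer Π l (plug C s) Σ' (layer-mono l (⨂-pack (deep-cut d C _ (⨂-R _))))
      (cast (flat-deep Π l (plug C Δ) Σ') e)

  deep-∨L : ∀ C c {A B} → tr* (plug C (fm A ∷ [])) ⊢ c → tr* (plug C (fm B ∷ [])) ⊢ c →
            tr* (plug C (fm (A ∨ᶠ B) ∷ [])) ⊢ c
  deep-∨L (hole Π Σ') c d e =
    cast (sym (flat-hole Π _ Σ'))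
      (L∨ {Γ = tr* Π} {Σ' = tr* Σ'} (cast (flat-hole Π _ Σ') d) (cast (flat-hole Π _ Σ') e))
  deep-∨L (deep Π l C Σ') c d e =
    cutLayer Π l _ Σ'
      (cut₁ (layer-mono l (⨂-pack (deep-∨L C _ (R∨₁ (⨂-R _)) (R∨₂ (⨂-R _))))) (layer-∨ l))
      (L∨ {Γ = tr* Π} {Σ' = tr* Σ'} (cast (flat-deep Π l _ Σ') d) (cast (flat-deep Π l _ Σ') e))

  deep-⊥L : ∀ C c → tr* (plug C (fm ⊥ᶠ ∷ [])) ⊢ c
  deep-⊥L (hole Π Σ') c = cast (sym (flat-hole Π _ Σ')) (bot {Γ = tr* Π} {Σ' = tr* Σ'})
  deep-⊥L (deep Π l C Σ') c =
    cutLayer Π l _ Σ' (cut₁ (layer-mono l (⨂-pack (deep-⊥L C ⊥ᶠ))) (layer-⊥ l))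
      (bot {Γ = tr* Π} {Σ' = tr* Σ'})

-- Writing G a = e ⇒ a, one always has ∇ ⊣ G; if moreover the unit and the
-- counit of this adjunction are invertible and ∇ is strong monoidal, then ∇
-- also preserves ∧, ⊤ and ⇒.
module CriterionH {c ℓ ι} (S : NCSpacetime c ℓ ι) where
  open NCSpacetime S

  ⇒-monoʳ : ∀ {a x y} → x ≤ y → (a ⇒ x) ≤ (a ⇒ y)
  ⇒-monoʳ x≤y = ⇒-intro (≤-trans (⇒-elim ≤-refl) x≤y)

  ∇G-counit : ∀ {x} → ∇ (e ⇒ x) ≤ x
  ∇G-counit = ≤-trans (proj₂ (⊗-idˡ _)) (⇒-elim ≤-refl)

  G∇-unit : ∀ {u} → u ≤ (e ⇒ ∇ u)
  G∇-unit = ⇒-intro (proj₁ (⊗-idˡ _))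

  criterion : (∇ e ≈ e) → (∀ a b → (∇ a ⊗ ∇ b) ≤ ∇ (a ⊗ b)) →
              (∀ a → a ≤ ∇ (e ⇒ a)) → (∀ a → (e ⇒ ∇ a) ≤ a) → Cond sH S
  criterion ∇-unit ∇-lax counit-inv unit-inv =
    ∇-unit , (λ a b → ∇-⊗ a b , ∇-lax a b) , ∇-∧ , ∇-⊤ , ∇-⇒
    where
    -- ∇ reflects the order, since G ∇ is the identity
    ∇-reflects : ∀ {u v} → ∇ u ≤ ∇ v → u ≤ v
    ∇-reflects {u} {v} ∇u≤∇v = ≤-trans G∇-unit (≤-trans (⇒-monoʳ ∇u≤∇v) (unit-inv v))

    ∇-∧ : ∀ a b → ∇ (a ∧ b) ≈ (∇ a ∧ ∇ b)
    ∇-∧ a b = ∧-glb (∇-mono (∧-lb₁ a b)) (∇-mono (∧-lb₂ a b))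
            , ≤-trans (counit-inv _) (∇-mono (∧-glb (≤-trans (⇒-monoʳ (∧-lb₁ _ _)) (unit-inv a))
                                                 (≤-trans (⇒-monoʳ (∧-lb₂ _ _)) (unit-inv b))))

    ∇-⊤ : ∇ ⊤q ≈ ⊤q
    ∇-⊤ = ⊤-max _ , ≤-trans (counit-inv ⊤q) (∇-mono (⊤-max _))

    ∇-⇒ : ∀ a b → ∇ (a ⇒ b) ≈ (∇ a ⇒ ∇ b)
    ∇-⇒ a b = ⇒-intro (≤-trans (∇-lax a (∇ (a ⇒ b))) (∇-mono (⇒-elim ≤-refl)))
            , ≤-trans (counit-inv _) (∇-mono (⇒-intro (∇-reflects
                (≤-trans (∇-⊗ a _)
                  (≤-trans (⊗-mono ≤-refl (∇-mono ∇G-counit)) (⇒-elim ≤-refl))))))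

module Canonical (ι : Level) (R : Scheme → Bool) (i : Bool) where
  open Derived R i

  Pred : Set (suc ι)
  Pred = List Struct → Set ι

  cl : Pred → Pred
  cl Q s = ∀ (C : Ctx) (c : Fm) → (∀ t → Q t → tr* (plug C t) ⊢ c) → tr* (plug C s) ⊢ c

  infix 4 _⊑_
  _⊑_ : Pred → Pred → Set ι
  P ⊑ Q = ∀ s → P s → cl Q s

  cl-incl : ∀ {Q s} → Q s → cl Q s
  cl-incl q C c h = h _ q

  cl-trans : ∀ {X Y s} → cl X s → X ⊑ Y → cl Y s
  cl-trans x X⊑Y C c h = x C c (λ t xt → X⊑Y t xt C c h)

  cl-derives : ∀ {X A s} → (∀ t → X t → tr* t ⊢ A) → cl X s → tr* s ⊢ A
  cl-derives {X} {A} {s} f x =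
    castTr (++-identityʳ s) (x (hole [] []) A (λ t xt → castTr (sym (++-identityʳ t)) (f t xt)))

  ⟨_⟩ : List Struct → Pred
  ⟨ Δ ⟩ s = Lift ι (s ≡ Δ)

  ⟨⟩-closure : ∀ {s Δ} → tr* s ⊢ ⨂ (tr* Δ) → cl ⟨ Δ ⟩ s
  ⟨⟩-closure d C c h = deep-cut d C c (h _ (lift refl))

  cl-entail : ∀ {Q s} Δ → tr* s ⊢ ⨂ (tr* Δ) → cl Q Δ → cl Q s
  cl-entail Δ d Δ∈Q = cl-trans (⟨⟩-closure {Δ = Δ} d) (λ { _ (lift refl) → Δ∈Q })

  infixr 7 _⊗ₚ_
  _⊗ₚ_ : Pred → Pred → Pred
  (P ⊗ₚ Q) s = Σ (List Struct) λ p → Σ (List Struct) λ q → P p × Q q × (s ≡ p ++ q)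

  cl-⊗ : ∀ {P Q x y} → cl P x → cl Q y → cl (P ⊗ₚ Q) (x ++ y)
  cl-⊗ {P} {Q} {x} {y} x∈P y∈Q C c h =
    castTr (plug-extendˡ C x y)
      (y∈Q (extendˡ C x) c (λ q q∈Q → castTr (sym (plug-extendˡ C x q)) (left q q∈Q)))
    where
    left : ∀ q → Q q → tr* (plug C (x ++ q)) ⊢ c
    left q q∈Q = castTr (plug-extendʳ C x q)
      (x∈P (extendʳ C q) c (λ p p∈P → castTr (sym (plug-extendʳ C p q))
                                               (h (p ++ q) (p , q , p∈P , q∈Q , refl))))

  layₚ : Layer → Pred → Pred
  layₚ l P s = Σ (List Struct) λ t → P t × (s ≡ lay l t ∷ [])

  cl-lay : ∀ {l P x} → cl P x → cl (layₚ l P) (lay l x ∷ [])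
  cl-lay {l} {P} {x} x∈P C c h =
    castTr (plug-inLayer l C x)
      (x∈P (inLayer l C) c (λ t t∈P → castTr (sym (plug-inLayer l C t)) (h _ (t , t∈P , refl))))

  eₚ : Pred
  eₚ = ⟨ [] ⟩

  ⋁ₚ : {I : Set ι} → (I → Pred) → Pred
  ⋁ₚ {I} f s = Σ I λ k → f k s

  _∧ₚ_ : Pred → Pred → Pred
  (P ∧ₚ Q) s = cl P s × cl Q s

  _⇒ₚ_ : Pred → Pred → Pred
  (P ⇒ₚ Q) q = ∀ p → P p → cl Q (p ++ lay ∇-layer q ∷ [])

  -- Predicates with ⊑ form a quantale; the laws hold up to closure, and the
  -- joins and the ⊗-laws hold already as inclusions of predicates.
  Quantaleₚ : Quantale (suc ι) ι ι
  Quantaleₚ = record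
    { Carrier = Pred
    ; _≤_ = _⊑_
    ; ≤-refl = λ s p → cl-incl p
    ; ≤-trans = λ P⊑Q Q⊑R s p → cl-trans (P⊑Q s p) Q⊑R
    ; _⊗_ = _⊗ₚ_
    ; e = eₚ
    ; ⊗-assoc = λ a b d →
        (λ { s (_ , r , (p , q , pa , qb , refl) , rd , refl) →
               cl-incl (p , q ++ r , pa , (q , r , qb , rd , refl) , ++-assoc p q r) })
      , (λ { s (p , _ , pa , (q , r , qb , rd , refl) , refl) →
               cl-incl (p ++ q , r , (p , q , pa , qb , refl) , rd , sym (++-assoc p q r)) })
    ; ⊗-idˡ = λ a → (λ { s (p , q , lift refl , qa , refl) → cl-incl qa })
                  , (λ s sa → cl-incl ([] , s , lift refl , sa , refl))
    ; ⊗-idʳ = λ a → (λ { s (p , q , pa , lift refl , refl) → subst (cl a) (sym (++-identityʳ p)) (cl-incl pa) })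
                  , (λ s sa → cl-incl (s , [] , sa , lift refl , sym (++-identityʳ s)))
    ; ⊗-mono = λ A B → λ { s (p , q , pa , qb , refl) → cl-⊗ (A p pa) (B q qb) }
    ; ⋁ = ⋁ₚ
    ; ⋁-ub = λ f k s x → cl-incl (k , x)
    ; ⋁-least = λ f b H → λ { s (k , x) → H k s x }
    ; ⊗-distribˡ = λ a f → (λ { s (p , q , pa , (k , qf) , refl) → cl-incl (k , (p , q , pa , qf , refl)) })
                         , (λ { s (k , (p , q , pa , qf , refl)) → cl-incl (p , q , pa , (k , qf) , refl) })
    ; ⊗-distribʳ = λ a f → (λ { s (p , q , (k , pf) , qa , refl) → cl-incl (k , (p , q , pf , qa , refl)) })
                         , (λ { s (k , (p , q , pf , qa , refl)) → cl-incl (p , q , (k , pf) , qa , refl) })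
    ; _∧_ = _∧ₚ_
    ; ∧-lb₁ = λ a b s x → proj₁ x
    ; ∧-lb₂ = λ a b s x → proj₂ x
    ; ∧-glb = λ A B s ds → cl-incl (A s ds , B s ds)
    ; ⊤q = λ _ → Lift ι ⊤
    ; ⊤-max = λ a s _ → cl-incl (lift tt)
    }

  ∇ₚ : Pred → Pred
  ∇ₚ = layₚ ∇-layer

  ∇-⨂-split : ∀ p q → ∇ᶠ (⨂ (tr* (p ++ q))) ∷ [] ⊢ ∇ᶠ (⨂ (tr* p)) ⊗ᶠ ∇ᶠ (⨂ (tr* q))
  ∇-⨂-split p q =
    cut₁ (∇rule (subst (λ z → ⨂ z ∷ [] ⊢ ⨂ (tr* p) ⊗ᶠ ⨂ (tr* q)) (sym (tr*-++ p q))
                       (⨂-split (tr* p) (tr* q))))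
         (oplax (R⊗ {Γ = ∇ᶠ (⨂ (tr* p)) ∷ []} {Σ' = ∇ᶠ (⨂ (tr* q)) ∷ []} ax ax))

  ∇ₚ-oplax : ∀ a b → ∇ₚ (a ⊗ₚ b) ⊑ ∇ₚ a ⊗ₚ ∇ₚ b
  ∇ₚ-oplax a b s (t , (p , q , pa , qb , refl) , refl) =
    cl-entail (lay ∇-layer p ∷ lay ∇-layer q ∷ []) (∇-⨂-split p q)
      (cl-incl (_ , _ , (p , pa , refl) , (q , qb , refl) , refl))

  plug-after : ∀ l C p q → plug (inLayer l (extendˡ C p)) q ≡ plug C (p ++ lay l q ∷ [])
  plug-after l C p q = trans (plug-inLayer l (extendˡ C p) q) (plug-extendˡ C p _)

  ⇒ₚ-intro : ∀ {a b d} → a ⊗ₚ ∇ₚ b ⊑ d → b ⊑ (a ⇒ₚ d)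
  ⇒ₚ-intro a∇b⊑d q q∈b =
    cl-incl (λ p p∈a → a∇b⊑d (p ++ lay ∇-layer q ∷ []) (p , _ , p∈a , (q , q∈b , refl) , refl))

  -- elimination tests q ∈ a ⇒ d in the context C[p, ∇(−)]
  ⇒ₚ-elim : ∀ {a b d} → b ⊑ (a ⇒ₚ d) → a ⊗ₚ ∇ₚ b ⊑ d
  ⇒ₚ-elim b⊑a⇒d s (p , _ , p∈a , (q , q∈b , refl) , refl) C c h =
    castTr (plug-after ∇-layer C p q)
      (b⊑a⇒d q q∈b (inLayer ∇-layer (extendˡ C p)) c
        (λ r r∈a⇒d → castTr (sym (plug-after ∇-layer C p r)) (r∈a⇒d p p∈a C c h)))

  Model : NCSpacetime (suc ι) ι ι
  Model = record
    { X = Quantaleₚ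
    ; ∇ = ∇ₚ
    ; ∇-mono = λ A → λ { s (t , tP , refl) → cl-lay (A t tP) }
    ; ∇-join = λ f → (λ { s (t , (k , x) , refl) → cl-incl (k , (t , x , refl)) })
                   , (λ { s (k , (t , x , refl)) → cl-incl (t , (k , x) , refl) })
    ; ∇-e = λ { s (t , lift refl , refl) → ⟨⟩-closure {Δ = []} ∇one }
    ; ∇-⊗ = ∇ₚ-oplax
    ; _⇒_ = _⇒ₚ_
    ; ⇒-intro = ⇒ₚ-intro
    ; ⇒-elim = ⇒ₚ-elim
    }

  module M = NCSpacetime Model

  V : ℕ → Pred
  V n = ⟨ fm (atom n) ∷ [] ⟩

  ⟦⟧-derives : ∀ A s → ⟦ Model ⟧ V A s → tr* s ⊢ A
  fm∈⟦⟧ : ∀ A → cl (⟦ Model ⟧ V A) (fm A ∷ [])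

  ⟦⟧-derives (atom n) s (lift refl) = ax
  ⟦⟧-derives ⊤ᶠ s _ = top
  ⟦⟧-derives ⊥ᶠ s (lift () , _)
  ⟦⟧-derives 𝟙ᶠ s (lift refl) = one
  ⟦⟧-derives (A ∧ᶠ B) s (x , y) = R∧ (cl-derives (⟦⟧-derives A) x) (cl-derives (⟦⟧-derives B) y)
  ⟦⟧-derives (A ∨ᶠ B) s (lift true , x) = R∨₁ (⟦⟧-derives A s x)
  ⟦⟧-derives (A ∨ᶠ B) s (lift false , x) = R∨₂ (⟦⟧-derives B s x)
  ⟦⟧-derives (A ⊗ᶠ B) s (p , q , pa , qb , refl) =
    cast (sym (tr*-++ p q)) (R⊗ {Γ = tr* p} {Σ' = tr* q} (⟦⟧-derives A p pa) (⟦⟧-derives B q qb))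
  ⟦⟧-derives (A →ᶠ B) q x = ⨂-unpack (R→ {Γ = ⨂ (tr* q) ∷ []} A-∇q⊢B)
    where
    -- x says that A, ∇q lies in the closure of ⟦B⟧
    A-∇q⊢B : A ∷ ∇ᶠ (⨂ (tr* q)) ∷ [] ⊢ B
    A-∇q⊢B = fm∈⟦⟧ A (hole [] (lay ∇-layer q ∷ [])) B (λ t ta → cl-derives (⟦⟧-derives B) (x t ta))
  ⟦⟧-derives (∇ᶠ A) s (t , ta , refl) = ∇rule (⨂-pack (⟦⟧-derives A t ta))

  fm∈⟦⟧ (atom n) = cl-incl (lift refl)
  fm∈⟦⟧ ⊤ᶠ = cl-incl (lift tt)
  fm∈⟦⟧ ⊥ᶠ = λ C c _ → deep-⊥L C c
  fm∈⟦⟧ 𝟙ᶠ = ⟨⟩-closure {Δ = []} ax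
  fm∈⟦⟧ (A ∧ᶠ B) =
    cl-incl ( cl-entail (fm A ∷ []) (L∧₁ {Γ = []} {Σ' = []} ax) (fm∈⟦⟧ A)
            , cl-entail (fm B ∷ []) (L∧₂ {Γ = []} {Σ' = []} ax) (fm∈⟦⟧ B))
  fm∈⟦⟧ (A ∨ᶠ B) C c h =
    deep-∨L C c (fm∈⟦⟧ A C c (λ t x → h t (lift true , x)))
                (fm∈⟦⟧ B C c (λ t x → h t (lift false , x)))
  fm∈⟦⟧ (A ⊗ᶠ B) =
    cl-entail (fm A ∷ fm B ∷ []) ax (cl-⊗ (fm∈⟦⟧ A) (fm∈⟦⟧ B))
  fm∈⟦⟧ (∇ᶠ A) =
    cl-entail (lay ∇-layer (fm A ∷ []) ∷ []) ax (cl-lay (fm∈⟦⟧ A))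
  fm∈⟦⟧ (A →ᶠ B) = cl-incl λ p pa → cl-entail (fm B ∷ []) (p-∇A→B⊢B p pa) (fm∈⟦⟧ B)
    where
    -- modus ponens against members of ⟦A⟧, which derive A
    p-∇A→B⊢B : ∀ p → ⟦ Model ⟧ V A p → tr* (p ++ lay ∇-layer (fm (A →ᶠ B) ∷ []) ∷ []) ⊢ B
    p-∇A→B⊢B p pa =
      cast (sym (tr*-++ p _)) (L→ {Γ = tr* p} {Π = []} {Σ' = []} (⟦⟧-derives A p pa) ax)

  fm* : List Fm → List Struct
  fm* [] = []
  fm* (A ∷ Γ) = fm A ∷ fm* Γ

  tr*-fm* : ∀ Γ → tr* (fm* Γ) ≡ Γ
  tr*-fm* [] = refl
  tr*-fm* (A ∷ Γ) = cong (A ∷_) (tr*-fm* Γ)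

  fm*∈⟦⟧* : ∀ Γ → cl (⟦ Model ⟧* V Γ) (fm* Γ)
  fm*∈⟦⟧* [] = cl-incl (lift refl)
  fm*∈⟦⟧* (A ∷ Γ) = cl-⊗ (fm∈⟦⟧ A) (fm*∈⟦⟧* Γ)

  completeness : ∀ Γ A → Valid Model Γ A → Γ ⊢ A
  completeness Γ A valid =
    cast (tr*-fm* Γ) (cl-derives (⟦⟧-derives A) (cl-trans (fm*∈⟦⟧* Γ) (valid V)))

  -- Frame conditions.  Each follows from the corresponding rule applied
  -- to points of the model.

  -- under N or H, necessitation makes ∇ₚ strong monoidal
  ∇ₚ-unit : T (R sN) ⊎ T (R sH) → M._≈_ (∇ₚ eₚ) eₚ
  ∇ₚ-unit nh = M.∇-e , λ { s (lift refl) →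
    cl-entail (lay ∇-layer [] ∷ []) (necessitation nh one) (cl-incl ([] , lift refl , refl)) }

  ∇ₚ-lax : T (R sN) ⊎ T (R sH) → ∀ a b → ∇ₚ a ⊗ₚ ∇ₚ b ⊑ ∇ₚ (a ⊗ₚ b)
  ∇ₚ-lax nh a b s (_ , _ , (p , pa , refl) , (q , qb , refl) , refl) =
    cl-entail (lay ∇-layer (p ++ q) ∷ []) (necessitation nh (⨂-++* p q))
      (cl-incl (p ++ q , (p , q , pa , qb , refl) , refl))

  -- the two invertibility hypotheses of CriterionH.criterion, using G-layers
  module _ (h : T (R sH)) where
    open WithH h

    ∇G-counit-invertible : ∀ a → a ⊑ ∇ₚ (eₚ ⇒ₚ a)
    ∇G-counit-invertible a s s∈a =
      cl-entail (lay ∇-layer Gs ∷ []) (⨂-unpack counit⁻¹) (cl-incl (Gs , Gs∈e⇒a , refl))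
      where
      Gs : List Struct
      Gs = fm (G (⨂ (tr* s))) ∷ []
      Gs∈e⇒a : (eₚ ⇒ₚ a) Gs
      Gs∈e⇒a = λ { p (lift refl) → cl-entail s counit (cl-incl s∈a) }

    G∇-unit-invertible : ∀ a → (eₚ ⇒ₚ ∇ₚ a) ⊑ a
    G∇-unit-invertible a q q∈G∇a C c tests =
      deep-cut {s = q} {Δ = lay (G-layer h) (lay ∇-layer q ∷ []) ∷ []} (⨂-unpack unit) C c
        (castTr (plug-inLayer (G-layer h) C _) through-G∇)
      where
      -- q ∈ e ⇒ ∇a tested in the context C[G(−)]; members ∇p of ∇a are
      -- turned back into p by unit⁻¹
      through-G∇ : tr* (plug (inLayer (G-layer h) C) (lay ∇-layer q ∷ [])) ⊢ c
      through-G∇ = q∈G∇a [] (lift refl) (inLayer (G-layer h) C) c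
        (λ { t (p , pa , refl) → castTr (sym (plug-inLayer (G-layer h) C _))
               (deep-cut {s = lay (G-layer h) (lay ∇-layer p ∷ []) ∷ []} {Δ = p}
                         unit⁻¹ C c (tests p pa)) })

  frame-conditions : InST R Model
  frame-conditions sN n = ∇ₚ-unit (inj₁ n) , λ a b → M.∇-⊗ a b , ∇ₚ-lax (inj₁ n) a b
  frame-conditions sH h =
    CriterionH.criterion Model (∇ₚ-unit (inj₂ h)) (∇ₚ-lax (inj₂ h))
                               (∇G-counit-invertible h) (G∇-unit-invertible h)
  frame-conditions sP p a s (t , ta , refl) =
    cl-entail t (ruleP p ax) (cl-incl ta)
  frame-conditions sF f a s sa =
    cl-entail (lay ∇-layer s ∷ []) (ruleF f (⨂-R _)) (cl-incl (s , sa , refl))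
  frame-conditions swF w a ∇a≈⊥ = a⊑⊥ , λ { s (lift () , _) }
    where
    -- if s ∈ a then ∇s ⊢ ⊥, so s ⊢ ⊥ by wF
    a⊑⊥ : a ⊑ M.⊥q
    a⊑⊥ s sa = cl-entail (fm ⊥ᶠ ∷ []) (⨂-unpack (rulewF w ∇s⊢⊥)) (λ C c _ → deep-⊥L C c)
      where
      ∇s⊢⊥ : ∇ᶠ (⨂ (tr* s)) ∷ [] ⊢ ⊥ᶠ
      ∇s⊢⊥ = cl-derives {X = M.⊥q} (λ { t (lift () , _) }) (proj₁ ∇a≈⊥ _ (s , sa , refl))

  module Structural (structural : T i) where

    weakenˡ : ∀ Γ {Δ c} → Δ ⊢ c → Γ ++ Δ ⊢ c
    weakenˡ [] d = d
    weakenˡ (A ∷ Γ) {Δ} d = weak {Γ = []} {Σ' = Γ ++ Δ} {A = A} structural (weakenˡ Γ d)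

    weakenʳ : ∀ {Γ c} Δ → Γ ⊢ c → Γ ++ Δ ⊢ c
    weakenʳ {Γ} [] d = cast (sym (++-identityʳ Γ)) d
    weakenʳ {Γ} (A ∷ Δ) d = weak {Γ = Γ} {Σ' = Δ} {A = A} structural (weakenʳ Δ d)

    duplicate : ∀ {X} → X ∷ [] ⊢ X ⊗ᶠ X
    duplicate {X} = contr {Γ = []} {Σ' = []} structural (R⊗ {Γ = X ∷ []} {Σ' = X ∷ []} ax ax)

    -- p ++ q entails both p and q (weakening)
    ⊗ₚ⊑∧ₚ : ∀ a b → a ⊗ₚ b ⊑ a ∧ₚ b
    ⊗ₚ⊑∧ₚ a b s (p , q , pa , qb , refl) =
      cl-incl ( cl-entail p (cast (sym (tr*-++ p q)) (weakenʳ (tr* q) (⨂-R (tr* p)))) (cl-incl pa)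
              , cl-entail q (cast (sym (tr*-++ p q)) (weakenˡ (tr* p) (⨂-R (tr* q)))) (cl-incl qb))

    -- s entails s ++ s (contraction)
    ∧ₚ⊑⊗ₚ : ∀ a b → a ∧ₚ b ⊑ a ⊗ₚ b
    ∧ₚ⊑⊗ₚ a b s (s∈a , s∈b) =
      cl-entail (s ++ s) (⨂-unpack (cut₁ duplicate (L⊗ {Γ = []} {Σ' = []} (⨂-++* s s)))) (cl-⊗ s∈a s∈b)

    locale : IsSpacetime Model
    locale = (λ a b → ⊗ₚ⊑∧ₚ a b , ∧ₚ⊑⊗ₚ a b) , (λ s _ → cl-incl (lift tt)) , ⊤ₚ⊑eₚ
      where
      -- every point entails 1
      ⊤ₚ⊑eₚ : M._≤_ M.⊤q eₚ
      ⊤ₚ⊑eₚ s _ = ⟨⟩-closure {s = s} {Δ = []} (cast (++-identityʳ (tr* s)) (weakenˡ (tr* s) one))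

theorem7p12 : (ι : Level) (R : Scheme → Bool) →
    (Σ (NCSpacetime (suc ι) ι ι) λ S → InST R S
    × (∀ (Γ : List Fm) (A : Fm) → Valid S Γ A → STL R Γ A))
    × (Σ (NCSpacetime (suc ι) ι ι) λ S → IsSpacetime S × InST R S
    × (∀ (Γ : List Fm) (A : Fm) → Valid S Γ A → iSTL R Γ A))
theorem7p12 ι R =
    (STLModel.Model , STLModel.frame-conditions , STLModel.completeness)
  , (iSTLModel.Model , iSTLModel.Structural.locale tt , iSTLModel.frame-conditions , iSTLModel.completeness)
  where
  module STLModel  = Canonical ι R false
  module iSTLModel = Canonical ι R true
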